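{- For all integers $t\ge 6$ and $s\ge 5$, $\mathrm{toi}(K_{2t}\times K_s)\ge ts$.
   Context: A graph $G$ contains a graph $F$ as a totally odd strong immersion if there is an injective map $\varphi: V(F)\to V(G)$ (terminals) and, for each edge $uv\in E(F)$, a path in $G$ between $\varphi(u)$ and $\varphi(v)$, such that these paths are pairwise edge-disjoint, no terminal is an interior vertex of any of them, and each has an odd number of edges. $\mathrm{toi}(G)$ is the maximum $t$ such that $G$ contains $K_t$ as a totally odd strong immersion. The direct product $G\times H$ has vertex set $V(G)\times V(H)$, with $(g_1,h_1)\sim(g_2,h_2)$ iff $g_1g_2\in E(G)$ and $h_1h_2\in E(H)$. -}

module Defs where

open import Data.Nat using (ℕ; suc; _%_; _≤_; _<_; _*_)
open import Data.Fin using (Fin)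
open import Data.Product using (_×_; _,_; Σ; ∃; ∃-syntax)
open import Data.Sum using (_⊎_)
open import Data.List using (List; []; _∷_; _++_; [_]; length)
open import Data.List.Membership.Propositional using (_∈_; _∉_)
open import Data.List.Relation.Unary.Linked using (Linked)
open import Data.List.Relation.Unary.Unique.Propositional using (Unique)
open import Relation.Binary.PropositionalEquality using (_≡_; _≢_)
open import Relation.Nullary using (¬_)
open import Function.Definitions using (Injective)

record Graph : Set₁ where
  field
    V   : Set
    Adj : V → V → Set
open Graph public

K : ℕ → Graph
K n = record { V = Fin n ; Adj = λ i j → i ≢ j }

_⊗_ : Graph → Graph → Graph
G ⊗ H = record
  { V   = V G × V H
  ; Adj = λ { (g₁ , h₁) (g₂ , h₂) → Adj G g₁ g₂ × Adj H h₁ h₂ } }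

steps : {A : Set} → List A → List (A × A)
steps []           = []
steps (x ∷ [])     = []
steps (x ∷ y ∷ xs) = (x , y) ∷ steps (y ∷ xs)

Odd : ℕ → Set
Odd n = n % 2 ≡ 1

record Path (G : Graph) (x y : V G) : Set where
  field
    inner : List (V G)
  verts : List (V G)
  verts = x ∷ inner ++ [ y ]
  field
    linked : Linked (Adj G) verts
    unique : Unique verts
  len : ℕ
  len = suc (length inner)
open Path public

UsesEdge : {G : Graph} {x y : V G} → Path G x y → V G → V G → Set
UsesEdge P a b = ((a , b) ∈ steps (verts P)) ⊎ ((b , a) ∈ steps (verts P))

-- G contains K_m as a totally odd strong immersion.
-- The edges of K_m are the pairs (i , j) with i < j.
record TOImmersion (m : ℕ) (G : Graph) : Set where
  field
    φ        : Fin m → V G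
    φ-inj    : Injective _≡_ _≡_ φ
    path     : (i j : Fin m) → i Data.Fin.< j → Path G (φ i) (φ j)
    odd      : (i j : Fin m) (p : i Data.Fin.< j) → Odd (len (path i j p))
    no-terminal-inside :
               (i j : Fin m) (p : i Data.Fin.< j) (k : Fin m) →
               φ k ∉ inner (path i j p)
    edge-disjoint :
               (i j : Fin m) (p : i Data.Fin.< j)
               (i' j' : Fin m) (p' : i' Data.Fin.< j') →
               ¬ ((i ≡ i') × (j ≡ j')) →
               (a b : V G) →
               UsesEdge (path i j p) a b → ¬ UsesEdge (path i' j' p') a b

toi≥ : Graph → ℕ → Set
toi≥ G k = Σ ℕ λ m → k ≤ m × TOImmersion m G

module Submission where

-- Put the ts terminals in the first t columns of K_2t × K_s and give each vertex
-- (p, q) there a shadow (p̄, q) in the last t columns. Terminals in distinct rows and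
-- columns are adjacent. The other pairs are oriented by tournaments on the columns
-- and on the rows in which every index beats its two cyclic successors p⁺ and p⁺⁺,
-- and are joined by a path of length 3 through shadows:
--   (p, q) – (p̄, q') – (p̄⁺, q) – (p, q')       if q → q',
--   (p, q) – (p̄', q⁺⁺) – (p̄, q⁺) – (p', q)     if p → p'.
-- Each arc of these paths determines its pair of ends: two pairs claiming the same
-- edge would make some index beat itself or be beaten by one of its two successors.
-- Such tournaments exist on n ≥ 5 points, so t ≥ 5 already suffices.

open import Defs
open import Data.Empty using (⊥-elim)
open import Data.Fin using (Fin; zero; suc; toℕ; fromℕ<; combine; remQuot)
import Data.Fin as Fin
open import Data.Fin.Properties
  using (toℕ-injective; toℕ<n; toℕ-fromℕ<; combine-injective; combine-remQuot)
  renaming (_≟_ to _≟ᶠ_)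
import Data.Fin.Properties as Fin
open import Data.List using ([]; _∷_)
open import Data.List.Membership.Propositional using (_∈_; _∉_)
open import Data.List.Relation.Unary.Any using (here; there)
open import Data.List.Relation.Unary.All using ([]; _∷_)
open import Data.List.Relation.Unary.AllPairs using ([]; _∷_)
open import Data.List.Relation.Unary.Linked using ([-]; _∷_)
open import Data.Nat using (ℕ; zero; suc; _+_; _*_; _≤_; _<_; z≤n; s≤s; s<s; s≤s⁻¹; z<s; _≟_)
open import Data.Nat.Properties using (≤-refl; <⇒≤; <-cmp; <-asym; n<1+n; ≤∧≢⇒<)
open import Data.Product using (_×_; _,_; proj₁; proj₂; ∃₂; uncurry; swap)
open import Data.Sum using (_⊎_; inj₁; inj₂; [_,_]′)
import Data.Sum as Sum
open import Function using (_∘_)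
open import Function.Definitions using (Injective)
open import Relation.Binary.Definitions using (Asymmetric; tri<; tri≈; tri>)
open import Relation.Binary.PropositionalEquality
  using (_≡_; _≢_; refl; sym; cong; cong₂; subst; ≢-sym; module ≡-Reasoning)
open import Relation.Nullary using (¬_; Dec; yes; no; contradiction)

record SuccessorTournament (A : Set) : Set₁ where
  field
    _⇒_            : A → A → Set
    ⇒-asym         : Asymmetric _⇒_
    ⇒-total        : ∀ {x y} → x ≢ y → x ⇒ y ⊎ y ⇒ x
    next           : A → A
    next-injective : Injective _≡_ _≡_ next
    ⇒-next         : ∀ x → x ⇒ next x
    ⇒-next²        : ∀ x → x ⇒ next (next x)

  ⇒-irrefl : ∀ {x y} → x ⇒ y → x ≢ y
  ⇒-irrefl x⇒x refl = ⇒-asym x⇒x x⇒x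

-- The transitive tournament on 0, …, n - 1 (n = 5 + k) with the three arcs
-- n - 2 → 0, n - 1 → 0 and n - 1 → 1 reversed: every a beats a + 1 and a + 2 mod n.
module FinSuccessorTournament (k : ℕ) where

  data Wraps : ℕ → ℕ → Set where
    n-2→0 : Wraps (3 + k) 0
    n-1→0 : Wraps (4 + k) 0
    n-1→1 : Wraps (4 + k) 1

  wraps? : ∀ a b → Dec (Wraps a b)
  wraps? a 0 with a ≟ 3 + k | a ≟ 4 + k
  ... | yes refl | _        = yes n-2→0
  ... | no _     | yes refl = yes n-1→0
  ... | no a≢n-2 | no a≢n-1 = no λ { n-2→0 → a≢n-2 refl ; n-1→0 → a≢n-1 refl }
  wraps? a 1 with a ≟ 4 + k
  ... | yes refl = yes n-1→1
  ... | no a≢n-1 = no λ { n-1→1 → a≢n-1 refl }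
  wraps? a (suc (suc b)) = no λ ()

  Wraps⇒> : ∀ {a b} → Wraps a b → b < a
  Wraps⇒> n-2→0 = z<s
  Wraps⇒> n-1→0 = z<s
  Wraps⇒> n-1→1 = s<s z<s

  Beats : ℕ → ℕ → Set
  Beats a b = (a < b × ¬ Wraps b a) ⊎ Wraps a b

  beats-asym : Asymmetric Beats
  beats-asym (inj₁ (a<b , _))   (inj₁ (b<a , _))   = <-asym a<b b<a
  beats-asym (inj₁ (_ , ¬ba))   (inj₂ ba)          = ¬ba ba
  beats-asym (inj₂ ab)          (inj₁ (_ , ¬ab))   = ¬ab ab
  beats-asym (inj₂ ab)          (inj₂ ba)          = <-asym (Wraps⇒> ab) (Wraps⇒> ba)

  beats-total : ∀ {a b} → a ≢ b → Beats a b ⊎ Beats b a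
  beats-total {a} {b} a≢b with <-cmp a b
  ... | tri≈ _ a≡b _ = contradiction a≡b a≢b
  ... | tri< a<b _ _ with wraps? b a
  ...   | yes ba  = inj₂ (inj₂ ba)
  ...   | no ¬ba  = inj₁ (inj₁ (a<b , ¬ba))
  beats-total {a} {b} a≢b | tri> _ _ b<a with wraps? a b
  ...   | yes ab  = inj₁ (inj₂ ab)
  ...   | no ¬ab  = inj₂ (inj₁ (b<a , ¬ab))

  data Step : ℕ → ℕ → Set where
    step : ∀ {a} → Step a (suc a)
    wrap : Step (4 + k) 0

  step-injective : ∀ {a b c} → Step a c → Step b c → a ≡ b
  step-injective step step = refl
  step-injective wrap wrap = refl

  step⇒beats : ∀ {a b} → Step a b → Beats a b
  step⇒beats step = inj₁ (n<1+n _ , λ ())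
  step⇒beats wrap = inj₂ n-1→0

  step²⇒beats : ∀ {a b c} → Step a b → Step b c → Beats a c
  step²⇒beats step step = inj₁ (s<s (<⇒≤ (n<1+n _)) , λ ())
  step²⇒beats step wrap = inj₂ n-2→0
  step²⇒beats wrap step = inj₂ n-1→1

  1+x<n : ∀ (x : Fin (5 + k)) → toℕ x ≢ 4 + k → suc (toℕ x) < 5 + k
  1+x<n x x≢n-1 = s<s (≤∧≢⇒< (s≤s⁻¹ (toℕ<n x)) x≢n-1)

  next : Fin (5 + k) → Fin (5 + k)
  next x with toℕ x ≟ 4 + k
  ... | yes _    = zero
  ... | no x≢n-1 = fromℕ< (1+x<n x x≢n-1)

  next-step : ∀ x → Step (toℕ x) (toℕ (next x))
  next-step x with toℕ x ≟ 4 + k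
  ... | yes x≡n-1 rewrite x≡n-1 = wrap
  ... | no x≢n-1 rewrite toℕ-fromℕ< (1+x<n x x≢n-1) = step

  next-injective : Injective _≡_ _≡_ next
  next-injective {x} {y} nx≡ny = toℕ-injective (step-injective (next-step x) y⇝nx)
    where
      y⇝nx : Step (toℕ y) (toℕ (next x))
      y⇝nx = subst (Step (toℕ y) ∘ toℕ) (sym nx≡ny) (next-step y)

  tournament : SuccessorTournament (Fin (5 + k))
  tournament = record
    { _⇒_            = λ x y → Beats (toℕ x) (toℕ y)
    ; ⇒-asym         = beats-asym
    ; ⇒-total        = λ x≢y → beats-total (x≢y ∘ toℕ-injective)
    ; next           = next
    ; next-injective = next-injective
    ; ⇒-next         = λ x → step⇒beats (next-step x)
    ; ⇒-next²        = λ x → step²⇒beats (next-step x) (next-step (next x))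
    }

successorTournament : ∀ {n} → 5 ≤ n → SuccessorTournament (Fin n)
successorTournament (s≤s (s≤s (s≤s (s≤s (s≤s (z≤n {k})))))) = FinSuccessorTournament.tournament k

module ShadowConstruction
  {t s : ℕ} (C : SuccessorTournament (Fin t)) (R : SuccessorTournament (Fin s)) where

  private
    module C = SuccessorTournament C
    module R = SuccessorTournament R

  G : Graph
  G = K (2 * t) ⊗ K s

  data Vertex : Set where
    tm sh : Fin t → Fin s → Vertex

  column : Vertex → Fin (2 * t)
  column (tm p _) = combine {2} zero p
  column (sh p _) = combine {2} (suc zero) p

  row : Vertex → Fin s
  row (tm _ q) = q
  row (sh _ q) = q

  ⟦_⟧ : Vertex → V G
  ⟦ x ⟧ = column x , row x

  combine₂-injective : ∀ (i j : Fin 2) {p p' : Fin t} → combine i p ≡ combine j p' → i ≡ j × p ≡ p'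
  combine₂-injective i j {p} {p'} = combine-injective i p j p'

  tm≢sh-column : ∀ {p p' : Fin t} → combine {2} zero p ≢ combine {2} (suc zero) p'
  tm≢sh-column e with () ← proj₁ (combine₂-injective zero (suc zero) e)

  ⟦⟧-injective : Injective _≡_ _≡_ ⟦_⟧
  ⟦⟧-injective {tm p q} {tm p' q'} e =
    cong₂ tm (proj₂ (combine₂-injective zero zero (cong proj₁ e))) (cong proj₂ e)
  ⟦⟧-injective {tm p q} {sh p' q'} e = contradiction (cong proj₁ e) tm≢sh-column
  ⟦⟧-injective {sh p q} {tm p' q'} e = contradiction (sym (cong proj₁ e)) tm≢sh-column
  ⟦⟧-injective {sh p q} {sh p' q'} e =
    cong₂ sh (proj₂ (combine₂-injective (suc zero) (suc zero) (cong proj₁ e))) (cong proj₂ e)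

  tm≢sh : ∀ {p p' q q'} → ⟦ tm p q ⟧ ≢ ⟦ sh p' q' ⟧
  tm≢sh = tm≢sh-column ∘ cong proj₁

  adjacent⇒≢ : ∀ {g g' h h'} → Adj G (g , h) (g' , h') → (g , h) ≢ (g' , h')
  adjacent⇒≢ (c≢c' , _) = c≢c' ∘ cong proj₁

  adjacent-sym : ∀ {g g' h h'} → Adj G (g , h) (g' , h') → Adj G (g' , h') (g , h)
  adjacent-sym (c≢c' , r≢r') = ≢-sym c≢c' , ≢-sym r≢r'

  tm-adjacent : ∀ {p p' q q'} → p ≢ p' → q ≢ q' → Adj G ⟦ tm p q ⟧ ⟦ tm p' q' ⟧
  tm-adjacent p≢p' q≢q' = p≢p' ∘ proj₂ ∘ combine₂-injective zero zero , q≢q'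

  sh-adjacent : ∀ {p p' q q'} → p ≢ p' → q ≢ q' → Adj G ⟦ sh p q ⟧ ⟦ sh p' q' ⟧
  sh-adjacent p≢p' q≢q' = p≢p' ∘ proj₂ ∘ combine₂-injective (suc zero) (suc zero) , q≢q'

  tm-sh-adjacent : ∀ {p p' q q'} → q ≢ q' → Adj G ⟦ tm p q ⟧ ⟦ sh p' q' ⟧
  tm-sh-adjacent q≢q' = tm≢sh-column , q≢q'

  sh-tm-adjacent : ∀ {p p' q q'} → q ≢ q' → Adj G ⟦ sh p q ⟧ ⟦ tm p' q' ⟧
  sh-tm-adjacent q≢q' = adjacent-sym (tm-sh-adjacent (≢-sym q≢q'))

  -- RouteArc P Q x y: x → y is an arc of the path from P to Q. The equations keep
  -- `next` out of the indices, so that two arcs can be compared by unification.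
  data RouteArc : Vertex → Vertex → Vertex → Vertex → Set where
    direct  : ∀ {p p' q q'} → p ≢ p' → q ≢ q' →
              RouteArc (tm p q) (tm p' q') (tm p q) (tm p' q')
    column₁ : ∀ {p q q'} → q R.⇒ q' →
              RouteArc (tm p q) (tm p q') (tm p q) (sh p q')
    column₂ : ∀ {p p⁺ q q'} → q R.⇒ q' → p⁺ ≡ C.next p →
              RouteArc (tm p q) (tm p q') (sh p q') (sh p⁺ q)
    column₃ : ∀ {p p⁺ q q'} → q R.⇒ q' → p⁺ ≡ C.next p →
              RouteArc (tm p q) (tm p q') (sh p⁺ q) (tm p q')
    row₁    : ∀ {p p' q q⁺⁺} → p C.⇒ p' → q⁺⁺ ≡ R.next (R.next q) →
              RouteArc (tm p q) (tm p' q) (tm p q) (sh p' q⁺⁺)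
    row₂    : ∀ {p p' q q⁺ q⁺⁺} → p C.⇒ p' → q⁺⁺ ≡ R.next (R.next q) → q⁺ ≡ R.next q →
              RouteArc (tm p q) (tm p' q) (sh p' q⁺⁺) (sh p q⁺)
    row₃    : ∀ {p p' q q⁺} → p C.⇒ p' → q⁺ ≡ R.next q →
              RouteArc (tm p q) (tm p' q) (sh p q⁺) (tm p' q)

  arc-adjacent : ∀ {P Q x y} → RouteArc P Q x y → Adj G ⟦ x ⟧ ⟦ y ⟧
  arc-adjacent (direct p≢p' q≢q')   = tm-adjacent p≢p' q≢q'
  arc-adjacent (column₁ q⇒q')       = tm-sh-adjacent (R.⇒-irrefl q⇒q')
  arc-adjacent (column₂ q⇒q' refl)  =
    sh-adjacent (C.⇒-irrefl (C.⇒-next _)) (≢-sym (R.⇒-irrefl q⇒q'))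
  arc-adjacent (column₃ q⇒q' refl)  = sh-tm-adjacent (R.⇒-irrefl q⇒q')
  arc-adjacent (row₁ _ refl)        = tm-sh-adjacent (R.⇒-irrefl (R.⇒-next² _))
  arc-adjacent (row₂ p⇒p' refl refl) =
    sh-adjacent (≢-sym (C.⇒-irrefl p⇒p')) (≢-sym (R.⇒-irrefl (R.⇒-next (R.next _))))
  arc-adjacent (row₃ _ refl)        = sh-tm-adjacent (≢-sym (R.⇒-irrefl (R.⇒-next _)))

  arc-unique : ∀ {P Q P' Q' x y} → RouteArc P Q x y → RouteArc P' Q' x y → P ≡ P' × Q ≡ Q'
  arc-unique (direct _ _)      (direct _ _)       = refl , refl
  arc-unique (column₁ _)       (column₁ _)        = refl , refl
  arc-unique (column₁ _)       (row₁ p⇒p _)       = ⊥-elim (C.⇒-irrefl p⇒p refl)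
  arc-unique (row₁ p⇒p _)      (column₁ _)        = ⊥-elim (C.⇒-irrefl p⇒p refl)
  arc-unique (row₁ _ _)        (row₁ _ _)         = refl , refl
  arc-unique (column₂ _ _)     (column₂ _ _)      = refl , refl
  arc-unique (column₂ _ refl)  (row₂ p⁺⇒p _ _)    = ⊥-elim (C.⇒-asym p⁺⇒p (C.⇒-next _))
  arc-unique (row₂ p⁺⇒p _ _)   (column₂ _ refl)   = ⊥-elim (C.⇒-asym p⁺⇒p (C.⇒-next _))
  arc-unique (row₂ _ _ refl)   (row₂ _ _ q⁺≡)     with refl ← R.next-injective q⁺≡ = refl , refl
  arc-unique (column₃ _ _)     (column₃ _ _)      = refl , refl
  arc-unique (column₃ q⁺⇒q _)  (row₃ _ refl)      = ⊥-elim (R.⇒-asym q⁺⇒q (R.⇒-next _))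
  arc-unique (row₃ _ refl)     (column₃ q⁺⇒q _)   = ⊥-elim (R.⇒-asym q⁺⇒q (R.⇒-next _))
  arc-unique (row₃ _ _)        (row₃ _ _)         = refl , refl

  arc-reversed : ∀ {P Q P' Q' x y} → RouteArc P Q x y → RouteArc P' Q' y x → P ≡ Q' × Q ≡ P'
  arc-reversed (direct _ _)          (direct _ _)          = refl , refl
  arc-reversed (column₁ _)           (column₃ _ _)         = refl , refl
  arc-reversed (column₃ _ _)         (column₁ _)           = refl , refl
  arc-reversed (column₁ _)           (row₃ p⇒p _)          = ⊥-elim (C.⇒-irrefl p⇒p refl)
  arc-reversed (row₃ p⇒p _)          (column₁ _)           = ⊥-elim (C.⇒-irrefl p⇒p refl)
  arc-reversed (row₁ _ refl)         (column₃ q⁺⁺⇒q _)     = ⊥-elim (R.⇒-asym q⁺⁺⇒q (R.⇒-next² _))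
  arc-reversed (column₃ q⁺⁺⇒q _)     (row₁ _ refl)         = ⊥-elim (R.⇒-asym q⁺⁺⇒q (R.⇒-next² _))
  arc-reversed (row₁ _ _)            (row₃ _ _)            = refl , refl
  arc-reversed (row₃ _ _)            (row₁ _ _)            = refl , refl
  arc-reversed (column₂ q⇒q' _)      (column₂ q'⇒q _)      = ⊥-elim (R.⇒-asym q⇒q' q'⇒q)
  arc-reversed (column₂ q⁺⁺⇒q⁺ _)    (row₂ _ refl refl)    = ⊥-elim (R.⇒-asym q⁺⁺⇒q⁺ (R.⇒-next _))
  arc-reversed (row₂ _ refl refl)    (column₂ q⁺⁺⇒q⁺ _)    = ⊥-elim (R.⇒-asym q⁺⁺⇒q⁺ (R.⇒-next _))
  arc-reversed (row₂ p⇒p' _ _)       (row₂ p'⇒p _ _)       = ⊥-elim (C.⇒-asym p⇒p' p'⇒p)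

  Carries : Vertex → Vertex → Vertex → Vertex → Set
  Carries P Q x y = RouteArc P Q x y ⊎ RouteArc Q P y x

  carries-unique : ∀ {P Q P' Q' x y} → Carries P Q x y → Carries P' Q' x y → P ≡ P' × Q ≡ Q'
  carries-unique (inj₁ a) (inj₁ a') = arc-unique a a'
  carries-unique (inj₁ a) (inj₂ a') = arc-reversed a a'
  carries-unique (inj₂ a) (inj₁ a') = swap (arc-reversed a a')
  carries-unique (inj₂ a) (inj₂ a') = swap (arc-unique a a')

  carries-adjacent : ∀ {P Q x y} → Carries P Q x y → Adj G ⟦ x ⟧ ⟦ y ⟧
  carries-adjacent = [ arc-adjacent , adjacent-sym ∘ arc-adjacent ]′

  CarriesEdge : Vertex → Vertex → Vertex → Vertex → Set
  CarriesEdge P Q x y = Carries P Q x y ⊎ Carries Q P x y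

  carriesEdge-unique : ∀ {P Q P' Q' x y} → CarriesEdge P Q x y → CarriesEdge P' Q' x y →
                       (P ≡ P' × Q ≡ Q') ⊎ (P ≡ Q' × Q ≡ P')
  carriesEdge-unique (inj₁ c) (inj₁ c') = inj₁ (carries-unique c c')
  carriesEdge-unique (inj₁ c) (inj₂ c') = inj₂ (carries-unique c c')
  carriesEdge-unique (inj₂ c) (inj₁ c') = inj₂ (swap (carries-unique c c'))
  carriesEdge-unique (inj₂ c) (inj₂ c') = inj₁ (swap (carries-unique c c'))

  record Route (P Q : Vertex) : Set where
    field
      path             : Path G ⟦ P ⟧ ⟦ Q ⟧
      odd              : Odd (len path)
      avoids-terminals : ∀ p q → ⟦ tm p q ⟧ ∉ inner path
      carried          : ∀ {a b} → (a , b) ∈ steps (verts path) →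
                         ∃₂ λ x y → ⟦ x ⟧ ≡ a × ⟦ y ⟧ ≡ b × Carries P Q x y

  direct-route : ∀ {p p' q q'} → p ≢ p' → q ≢ q' → Route (tm p q) (tm p' q')
  direct-route p≢p' q≢q' = record
    { path             = record
      { inner  = []
      ; linked = tm-adjacent p≢p' q≢q' ∷ [-]
      ; unique = (adjacent⇒≢ (tm-adjacent p≢p' q≢q') ∷ []) ∷ [] ∷ []
      }
    ; odd              = refl
    ; avoids-terminals = λ _ _ ()
    ; carried          = λ { (here refl) → _ , _ , refl , refl , inj₁ (direct p≢p' q≢q')
                           ; (there ()) }
    }

  detour-route : ∀ {p p' q q' x x' y y'} →
                 let P = tm p q ; X = sh x y ; Y = sh x' y' ; Q = tm p' q' in
                 P ≢ Q → Carries P Q P X → Carries P Q X Y → Carries P Q Y Q → Route P Q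
  detour-route P≢Q c₁ c₂ c₃ = record
    { path             = record
      { inner  = _ ∷ _ ∷ []
      ; linked = carries-adjacent c₁ ∷ carries-adjacent c₂ ∷ carries-adjacent c₃ ∷ [-]
      ; unique = (tm≢sh ∷ tm≢sh ∷ P≢Q ∘ ⟦⟧-injective ∷ [])
               ∷ (adjacent⇒≢ (carries-adjacent c₂) ∷ ≢-sym tm≢sh ∷ [])
               ∷ (≢-sym tm≢sh ∷ [])
               ∷ [] ∷ []
      }
    ; odd              = refl
    ; avoids-terminals = λ { _ _ (here e)         → tm≢sh e
                           ; _ _ (there (here e)) → tm≢sh e
                           ; _ _ (there (there ())) }
    ; carried          = λ { (here refl)                 → _ , _ , refl , refl , c₁
                           ; (there (here refl))         → _ , _ , refl , refl , c₂
                           ; (there (there (here refl))) → _ , _ , refl , refl , c₃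
                           ; (there (there (there ()))) }
    }

  detour-routes : ∀ {p p' q q' x x' y y'} →
                  let P = tm p q ; X = sh x y ; Y = sh x' y' ; Q = tm p' q' in
                  P ≢ Q → RouteArc P Q P X → RouteArc P Q X Y → RouteArc P Q Y Q →
                  Route P Q × Route Q P
  detour-routes P≢Q a₁ a₂ a₃ =
    detour-route P≢Q (inj₁ a₁) (inj₁ a₂) (inj₁ a₃) ,
    detour-route (≢-sym P≢Q) (inj₂ a₃) (inj₂ a₂) (inj₂ a₁)

  column-routes : ∀ p {q q'} → q R.⇒ q' → Route (tm p q) (tm p q') × Route (tm p q') (tm p q)
  column-routes p q⇒q' =
    detour-routes (λ { refl → R.⇒-irrefl q⇒q' refl })
                  (column₁ q⇒q') (column₂ q⇒q' refl) (column₃ q⇒q' refl)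

  row-routes : ∀ q {p p'} → p C.⇒ p' → Route (tm p q) (tm p' q) × Route (tm p' q) (tm p q)
  row-routes q p⇒p' =
    detour-routes (λ { refl → C.⇒-irrefl p⇒p' refl })
                  (row₁ p⇒p' refl) (row₂ p⇒p' refl refl) (row₃ p⇒p' refl)

  route : ∀ {p p' q q'} → (p , q) ≢ (p' , q') → Route (tm p q) (tm p' q')
  route {p} {p'} {q} {q'} pq≢p'q' with p ≟ᶠ p' | q ≟ᶠ q'
  ... | yes refl | yes refl = contradiction refl pq≢p'q'
  ... | no p≢p'  | no q≢q'  = direct-route p≢p' q≢q'
  ... | yes refl | no q≢q'  with R.⇒-total q≢q'
  ...   | inj₁ q⇒q' = proj₁ (column-routes p q⇒q')
  ...   | inj₂ q'⇒q = proj₂ (column-routes p q'⇒q)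
  route {p} {p'} {q} pq≢p'q' | no p≢p' | yes refl with C.⇒-total p≢p'
  ...   | inj₁ p⇒p' = proj₁ (row-routes q p⇒p')
  ...   | inj₂ p'⇒p = proj₂ (row-routes q p'⇒p)

  edge-carrier : ∀ {P Q a b} (r : Route P Q) → UsesEdge (Route.path r) a b →
                 ∃₂ λ x y → ⟦ x ⟧ ≡ a × ⟦ y ⟧ ≡ b × CarriesEdge P Q x y
  edge-carrier r (inj₁ ab∈) with Route.carried r ab∈
  ... | x , y , ⟦x⟧≡a , ⟦y⟧≡b , c = x , y , ⟦x⟧≡a , ⟦y⟧≡b , inj₁ c
  edge-carrier r (inj₂ ba∈) with Route.carried r ba∈
  ... | y , x , ⟦y⟧≡b , ⟦x⟧≡a , c = x , y , ⟦x⟧≡a , ⟦y⟧≡b , inj₂ (Sum.swap c)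

  shared-edge⇒same-ends : ∀ {P Q P' Q' a b} (r : Route P Q) (r' : Route P' Q') →
                UsesEdge (Route.path r) a b → UsesEdge (Route.path r') a b →
                (P ≡ P' × Q ≡ Q') ⊎ (P ≡ Q' × Q ≡ P')
  shared-edge⇒same-ends r r' u u' with edge-carrier r u | edge-carrier r' u'
  ... | x , y , refl , refl , c | x' , y' , ⟦x'⟧≡⟦x⟧ , ⟦y'⟧≡⟦y⟧ , c'
      with refl ← ⟦⟧-injective {x'} {x} ⟦x'⟧≡⟦x⟧ | refl ← ⟦⟧-injective {y'} {y} ⟦y'⟧≡⟦y⟧
      = carriesEdge-unique c c'

  position : Fin (t * s) → Fin t × Fin s
  position = remQuot s

  position-injective : Injective _≡_ _≡_ position
  position-injective {i} {j} e = begin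
    i                            ≡⟨ combine-remQuot {t} s i ⟨
    uncurry combine (position i) ≡⟨ cong (uncurry combine) e ⟩
    uncurry combine (position j) ≡⟨ combine-remQuot {t} s j ⟩
    j                            ∎
    where open ≡-Reasoning

  terminal : Fin (t * s) → Vertex
  terminal = uncurry tm ∘ position

  terminal-injective : Injective _≡_ _≡_ terminal
  terminal-injective e = position-injective (tm-injective e)
    where
      tm-injective : ∀ {p p' q q'} → tm p q ≡ tm p' q' → (p , q) ≡ (p' , q')
      tm-injective refl = refl

  terminal-route : ∀ {i j} → i Fin.< j → Route (terminal i) (terminal j)
  terminal-route i<j = route λ e → Fin.<-irrefl (position-injective e) i<j

  immersion : TOImmersion (t * s) G
  immersion = record
    { φ                  = ⟦_⟧ ∘ terminal
    ; φ-inj              = terminal-injective ∘ ⟦⟧-injective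
    ; path               = λ _ _ i<j → Route.path (terminal-route i<j)
    ; odd                = λ _ _ i<j → Route.odd (terminal-route i<j)
    ; no-terminal-inside = λ _ _ i<j _ → Route.avoids-terminals (terminal-route i<j) _ _
    ; edge-disjoint      = edge-disjoint
    }
    where
      edge-disjoint : ∀ i j (i<j : i Fin.< j) i' j' (i'<j' : i' Fin.< j') →
                      ¬ (i ≡ i' × j ≡ j') → ∀ a b →
                      UsesEdge (Route.path (terminal-route i<j)) a b →
                      ¬ UsesEdge (Route.path (terminal-route i'<j')) a b
      edge-disjoint i j i<j i' j' i'<j' ij≢i'j' a b u u'
        with shared-edge⇒same-ends (terminal-route i<j) (terminal-route i'<j') u u'
      ... | inj₁ (e , e') = ij≢i'j' (terminal-injective e , terminal-injective e')
      ... | inj₂ (e , e') with refl ← terminal-injective e | refl ← terminal-injective e'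
          = Fin.<-asym i<j i'<j'

theorem8 : (t s : ℕ) → 6 ≤ t → 5 ≤ s → toi≥ (K (2 * t) ⊗ K s) (t * s)
theorem8 t s 6≤t 5≤s =
  t * s , ≤-refl ,
  ShadowConstruction.immersion (successorTournament (<⇒≤ 6≤t)) (successorTournament 5≤s)
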